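{- If a deck $D$ of order $n$ has at least $n^2-2n+2$ cards, then every card of $D$ contains a symbol of multiplicity $n$.
   Context: A deck consists of a finite set $S$ of symbols together with a finite collection $D$ of distinct cards, each card being a subset of $S$, satisfying: (D1) any two distinct cards have exactly one symbol in common; (D2) every symbol of $S$ lies on at least two cards; (D3) every card contains at least two symbols; (D4) all cards have the same cardinality $n$ (the order); (D5) $S$ is nonempty. For $s\in S$, the multiplicity $m(s)$ is the number of cards containing $s$. -}

module Defs where

open import Data.Nat using (ℕ; _≤_; _*_; _+_; _∸_)
open import Data.Fin using (Fin)
open import Data.Fin.Subset using (Subset; _∩_; ∣_∣; _∈_)
open import Data.Fin.Subset.Properties using (_∈?_)
open import Data.Vec.Functional using (Vector)
open import Data.List using (allFin; filter; length)
open import Relation.Binary.PropositionalEquality using (_≡_)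
open import Relation.Nullary using (¬_)
open import Data.Product using (Σ; _×_)

-- A deck with symbol set S = Fin s and c cards, card i being  cards i ⊆ Fin s.
-- Distinctness of cards is injectivity of the indexing.
record IsDeck (s c n : ℕ) (cards : Fin c → Subset s) : Set where
  field
    distinct    : ∀ i j → cards i ≡ cards j → i ≡ j
    oneCommon   : ∀ i j → ¬ (i ≡ j) → ∣ cards i ∩ cards j ∣ ≡ 1
    symbolOnTwo : ∀ (x : Fin s) → 2 ≤ length (filter (λ i → x ∈? cards i) (allFin c))
    cardHasTwo  : ∀ i → 2 ≤ ∣ cards i ∣
    order       : ∀ i → ∣ cards i ∣ ≡ n
    nonempty    : 1 ≤ s

multiplicity : ∀ {s c} → (Fin c → Subset s) → Fin s → ℕ
multiplicity {c = c} cards x = length (filter (λ i → x ∈? cards i) (allFin c))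

-- Let card Cᵢ have no symbol of multiplicity n. Every symbol x has m(x) ≤ n: pick a
-- card K avoiding x; the cards through x meet K in pairwise distinct symbols, since two
-- cards sharing two symbols would coincide. Hence m(x) ≤ n - 1 for x ∈ Cᵢ, and counting
-- the pairs (x, j) with x ∈ Cᵢ ∩ Cⱼ gives  (c - 1) + n = ∑ⱼ |Cᵢ ∩ Cⱼ| = ∑_{x ∈ Cᵢ} m(x)
-- ≤ n (n - 1),  i.e. c ≤ n² - 2n + 1.
module Submission where

open import Defs
open import Data.Bool.Base using (if_then_else_)
open import Data.Empty using (⊥-elim)
open import Data.Fin using (Fin; zero; suc)
open import Data.Fin.Properties using (any?) renaming (_≟_ to _≟ᶠ_; 0≢1+n to 0≢1+nᶠ; suc-injective to suc-injectiveᶠ)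
open import Data.Fin.Subset using (Subset; _∈_; _∉_; _∩_; ∣_∣; inside; outside)
open import Data.Fin.Subset.Properties using (_∈?_; x∈p∩q⁺; x∈p∩q⁻; ∩-idem)
open import Data.List using (filter; length; tabulate)
open import Data.Nat using (ℕ; zero; suc; pred; _≤_; _*_; _+_; _∸_; z≤n; s≤s; _<_; >-nonZero)
open import Data.Nat.Properties
open import Data.Nat.Tactic.RingSolver using (solve-∀)
open import Data.Product using (Σ; _×_; _,_; ∃)
open import Data.Vec using (_∷_; [])
open import Function using (_∘_)
open import Level using (Level)
open import Relation.Binary.PropositionalEquality using (_≡_; refl; sym; trans; cong; cong₂; subst; module ≡-Reasoning)
open import Relation.Nullary using (¬_; Dec; yes; no; does; ¬?)
open import Relation.Nullary.Decidable using (_×-dec_; decidable-stable)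
open import Relation.Unary using (Pred; Decidable)

open import Algebra.Properties.Semiring.Sum +-*-semiring
  using (sum; sum-syntax; sum-cong-≗; ∑-comm; ∑-distrib-+; *-distribˡ-sum; *-distribʳ-sum)

private
  variable
    k : ℕ
    ℓ ℓ₁ ℓ₂ : Level
    P : Set ℓ₁
    Q : Set ℓ₂

𝟙 : Dec P → ℕ
𝟙 d = if does d then 1 else 0

𝟙-yes : (d : Dec P) → P → 𝟙 d ≡ 1
𝟙-yes (yes _) _ = refl
𝟙-yes (no ¬p) p = ⊥-elim (¬p p)

𝟙-no : (d : Dec P) → ¬ P → 𝟙 d ≡ 0
𝟙-no (yes p) ¬p = ⊥-elim (¬p p)
𝟙-no (no _)  _  = refl

𝟙-cong : (P → Q) → (Q → P) → (d : Dec P) (e : Dec Q) → 𝟙 d ≡ 𝟙 e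
𝟙-cong f g (yes _) (yes _) = refl
𝟙-cong f g (yes p) (no ¬q) = ⊥-elim (¬q (f p))
𝟙-cong f g (no ¬p) (yes q) = ⊥-elim (¬p (g q))
𝟙-cong f g (no _)  (no _)  = refl

𝟙-×-dec : (d : Dec P) (e : Dec Q) → 𝟙 (d ×-dec e) ≡ 𝟙 d * 𝟙 e
𝟙-×-dec (yes _) (yes _) = refl
𝟙-×-dec (yes _) (no _)  = refl
𝟙-×-dec (no _)  _       = refl

𝟙*-monoʳ-≤ : ∀ {r t} (d : Dec P) → (P → r ≤ t) → 𝟙 d * r ≤ 𝟙 d * t
𝟙*-monoʳ-≤ (yes p) r≤t = *-monoʳ-≤ 1 (r≤t p)
𝟙*-monoʳ-≤ (no _)  _   = z≤n

sum-mono-≤ : {f g : Fin k → ℕ} → (∀ i → f i ≤ g i) → sum f ≤ sum g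
sum-mono-≤ {zero}  _   = z≤n
sum-mono-≤ {suc k} f≤g = +-mono-≤ (f≤g zero) (sum-mono-≤ (f≤g ∘ suc))

∑-const-1 : ∀ k → ∑[ i < k ] 1 ≡ k
∑-const-1 zero    = refl
∑-const-1 (suc k) = cong suc (∑-const-1 k)

term≤sum : (t : Fin k → ℕ) (i : Fin k) → t i ≤ sum t
term≤sum t zero    = m≤m+n _ _
term≤sum t (suc i) = ≤-trans (term≤sum (t ∘ suc) i) (m≤n+m _ _)

two-terms≤sum : (t : Fin k → ℕ) {i j : Fin k} → ¬ i ≡ j → t i + t j ≤ sum t
two-terms≤sum t {zero}  {zero}  i≢j = ⊥-elim (i≢j refl)
two-terms≤sum t {zero}  {suc j} _   = +-monoʳ-≤ (t zero) (term≤sum (t ∘ suc) j)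
two-terms≤sum t {suc i} {zero}  _   =
  subst (_≤ sum t) (+-comm (t zero) (t (suc i))) (+-monoʳ-≤ (t zero) (term≤sum (t ∘ suc) i))
two-terms≤sum t {suc i} {suc j} i≢j =
  ≤-trans (two-terms≤sum (t ∘ suc) (i≢j ∘ cong suc)) (m≤n+m _ _)

size+pred≤sum : (t : Fin k → ℕ) → (∀ j → 1 ≤ t j) → (i : Fin k) → k + pred (t i) ≤ sum t
size+pred≤sum {k} t t≥1 i = begin
  k + pred (t i)                        ≤⟨ +-mono-≤ (≤-reflexive (sym (∑-const-1 k))) (term≤sum (pred ∘ t) i) ⟩
  ∑[ j < k ] 1 + ∑[ j < k ] pred (t j)  ≡⟨ sym (∑-distrib-+ (λ _ → 1) (pred ∘ t)) ⟩
  ∑[ j < k ] suc (pred (t j))           ≡⟨ sum-cong-≗ (λ j → suc-pred (t j) {{>-nonZero (t≥1 j)}}) ⟩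
  sum t                                 ∎
  where open ≤-Reasoning

count : {P : Pred (Fin k) ℓ} → Decidable P → ℕ
count {k} P? = ∑[ i < k ] 𝟙 (P? i)

count≥2 : {P : Pred (Fin k) ℓ} (P? : Decidable P) → ∀ {i j} → P i → P j → ¬ i ≡ j → 2 ≤ count P?
count≥2 P? {i} {j} pᵢ pⱼ i≢j =
  subst (_≤ count P?) (cong₂ _+_ (𝟙-yes (P? i) pᵢ) (𝟙-yes (P? j) pⱼ)) (two-terms≤sum (𝟙 ∘ P?) i≢j)

count-none : {P : Pred (Fin k) ℓ} (P? : Decidable P) → (∀ i → ¬ P i) → count P? ≡ 0
count-none {zero}  P? _  = refl
count-none {suc k} P? ¬P = cong₂ _+_ (𝟙-no (P? zero) (¬P zero)) (count-none (P? ∘ suc) (¬P ∘ suc))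

count≤1 : {P : Pred (Fin k) ℓ} (P? : Decidable P) → (∀ i j → P i → P j → i ≡ j) → count P? ≤ 1
count≤1 {zero}  P? _ = z≤n
count≤1 {suc k} P? unique with P? zero
... | yes p₀ = ≤-reflexive (cong suc (count-none (P? ∘ suc) (λ i pᵢ → 0≢1+nᶠ (unique zero (suc i) p₀ pᵢ))))
... | no _   = count≤1 (P? ∘ suc) (λ i j pᵢ pⱼ → suc-injectiveᶠ (unique (suc i) (suc j) pᵢ pⱼ))

count≥2⇒another : {P : Pred (Fin k) ℓ} (P? : Decidable P) → 2 ≤ count P? →
                  (i : Fin k) → ∃ λ j → P j × ¬ j ≡ i
count≥2⇒another {P = P} P? count≥2 i with any? (λ j → P? j ×-dec ¬? (j ≟ᶠ i))
... | yes found = found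
... | no none    = ⊥-elim (<⇒≱ count≥2 (count≤1 P? λ j j′ pⱼ pⱼ′ → trans (≡i pⱼ) (sym (≡i pⱼ′))))
  where
  ≡i : ∀ {j} → P j → j ≡ i
  ≡i {j} pⱼ with j ≟ᶠ i
  ... | yes j≡i = j≡i
  ... | no j≢i  = ⊥-elim (none (j , pⱼ , j≢i))

-- 𝟙 ignores the proof inside a decision, so the `map′` in `suc x ∈? s ∷ p` is invisible.
∣p∣≡count : (A : Subset k) → ∣ A ∣ ≡ count (_∈? A)
∣p∣≡count []            = refl
∣p∣≡count (inside ∷ A)  = cong suc (∣p∣≡count A)
∣p∣≡count (outside ∷ A) = ∣p∣≡count A

∣p∩q∣≡count : (A B : Subset k) → ∣ A ∩ B ∣ ≡ count (λ x → x ∈? A ×-dec x ∈? B)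
∣p∩q∣≡count A B = trans (∣p∣≡count (A ∩ B))
  (sum-cong-≗ λ x → 𝟙-cong (x∈p∩q⁻ A B) x∈p∩q⁺ (x ∈? A ∩ B) (x ∈? A ×-dec x ∈? B))

∣p∩q∣≡∑𝟙*𝟙 : (A B : Subset k) → ∣ A ∩ B ∣ ≡ ∑[ x < k ] (𝟙 (x ∈? A) * 𝟙 (x ∈? B))
∣p∩q∣≡∑𝟙*𝟙 A B = trans (∣p∩q∣≡count A B) (sum-cong-≗ λ x → 𝟙-×-dec (x ∈? A) (x ∈? B))

length-filter-tabulate : {A : Set} {P : Pred A ℓ} (P? : Decidable P) (f : Fin k → A) →
                         length (filter P? (tabulate f)) ≡ count (P? ∘ f)
length-filter-tabulate {k = zero}  P? f = refl
length-filter-tabulate {k = suc k} P? f with P? (f zero)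
... | yes _ = cong suc (length-filter-tabulate P? (f ∘ suc))
... | no _  = length-filter-tabulate P? (f ∘ suc)

multiplicity≡count : ∀ {s c} (cards : Fin c → Subset s) (x : Fin s) →
                     multiplicity cards x ≡ count (λ j → x ∈? cards j)
multiplicity≡count cards x = length-filter-tabulate (λ j → x ∈? cards j) (λ j → j)

∑-weighted-∣∩∣ : ∀ {s c} (cards : Fin c → Subset s) (f : Fin c → ℕ) (A : Subset s) →
  ∑[ j < c ] (f j * ∣ cards j ∩ A ∣) ≡ ∑[ y < s ] (𝟙 (y ∈? A) * ∑[ j < c ] (f j * 𝟙 (y ∈? cards j)))
∑-weighted-∣∩∣ {s} {c} cards f A = begin
  ∑[ j < c ] (f j * ∣ cards j ∩ A ∣)
    ≡⟨ sum-cong-≗ (λ j → cong (f j *_) (∣p∩q∣≡∑𝟙*𝟙 (cards j) A)) ⟩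
  ∑[ j < c ] (f j * ∑[ y < s ] (χ y j * 𝟙 (y ∈? A)))
    ≡⟨ sum-cong-≗ (λ j → *-distribˡ-sum (f j) (λ y → χ y j * 𝟙 (y ∈? A))) ⟩
  ∑[ j < c ] ∑[ y < s ] (f j * (χ y j * 𝟙 (y ∈? A)))
    ≡⟨ ∑-comm (λ j y → f j * (χ y j * 𝟙 (y ∈? A))) ⟩
  ∑[ y < s ] ∑[ j < c ] (f j * (χ y j * 𝟙 (y ∈? A)))
    ≡⟨ sum-cong-≗ (λ y → sum-cong-≗ (λ j → rearrange (f j) (χ y j) (𝟙 (y ∈? A)))) ⟩
  ∑[ y < s ] ∑[ j < c ] (𝟙 (y ∈? A) * (f j * χ y j))
    ≡⟨ sum-cong-≗ (λ y → sym (*-distribˡ-sum (𝟙 (y ∈? A)) (λ j → f j * χ y j))) ⟩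
  ∑[ y < s ] (𝟙 (y ∈? A) * ∑[ j < c ] (f j * χ y j)) ∎
  where
  open ≡-Reasoning
  χ : Fin s → Fin c → ℕ
  χ y j = 𝟙 (y ∈? cards j)
  rearrange : ∀ a b d → a * (b * d) ≡ d * (a * b)
  rearrange = solve-∀

n*n+2∸2*n≤c⇒n*pred[n]<c+pred[n] : ∀ n c → n * n + 2 ∸ 2 * n ≤ c → n * pred n < c + pred n
n*n+2∸2*n≤c⇒n*pred[n]<c+pred[n] zero    c 2≤c = ≤-trans (s≤s z≤n) (≤-trans 2≤c (m≤m+n c 0))
n*n+2∸2*n≤c⇒n*pred[n]<c+pred[n] (suc m) c bound = begin-strict
  suc m * m     ≡⟨ +-comm m (m * m) ⟩
  m * m + m     <⟨ +-monoˡ-< m m*m<c ⟩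
  c + m         ∎
  where
  open ≤-Reasoning
  square : ∀ m → suc m * suc m + 2 ≡ suc (m * m) + 2 * suc m
  square = solve-∀
  m*m<c : m * m < c
  m*m<c = subst (_≤ c) (trans (cong (_∸ 2 * suc m) (square m)) (m+n∸n≡m (suc (m * m)) (2 * suc m))) bound

module DeckProperties {s c n : ℕ} {cards : Fin c → Subset s} (deck : IsDeck s c n cards) where
  open IsDeck deck

  χ : Fin s → Fin c → ℕ
  χ x j = 𝟙 (x ∈? cards j)

  another-symbol : ∀ i x → ∃ λ y → y ∈ cards i × ¬ y ≡ x
  another-symbol i = count≥2⇒another (_∈? cards i) (subst (2 ≤_) (∣p∣≡count (cards i)) (cardHasTwo i))

  another-card : ∀ x i → ∃ λ j → x ∈ cards j × ¬ j ≡ i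
  another-card x = count≥2⇒another (λ j → x ∈? cards j) (subst (2 ≤_) (multiplicity≡count cards x) (symbolOnTwo x))

  common-card-unique : ∀ {x y j j′} → ¬ x ≡ y →
    x ∈ cards j → y ∈ cards j → x ∈ cards j′ → y ∈ cards j′ → j ≡ j′
  common-card-unique {x} {y} {j} {j′} x≢y xⱼ yⱼ xⱼ′ yⱼ′ with j ≟ᶠ j′
  ... | yes j≡j′ = j≡j′
  ... | no j≢j′  = ⊥-elim (<⇒≱ two-common (≤-reflexive (oneCommon j j′ j≢j′)))
    where
    two-common : 2 ≤ ∣ cards j ∩ cards j′ ∣
    two-common = subst (2 ≤_) (sym (∣p∩q∣≡count (cards j) (cards j′)))
      (count≥2 (λ z → z ∈? cards j ×-dec z ∈? cards j′) (xⱼ , xⱼ′) (yⱼ , yⱼ′) x≢y)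

  cards-through-two-symbols≤1 : ∀ {x y} → ¬ x ≡ y → ∑[ j < c ] (χ x j * χ y j) ≤ 1
  cards-through-two-symbols≤1 {x} {y} x≢y = subst (_≤ 1)
    (sum-cong-≗ (λ j → 𝟙-×-dec (x ∈? cards j) (y ∈? cards j)))
    (count≤1 (λ j → x ∈? cards j ×-dec y ∈? cards j)
      (λ j j′ (xⱼ , yⱼ) (xⱼ′ , yⱼ′) → common-card-unique x≢y xⱼ yⱼ xⱼ′ yⱼ′))

  -- If x lay on every card, x and another symbol y of card i would share card i and a second card through y.
  symbol-avoided : ∀ {x i} → x ∈ cards i → ∃ λ k → x ∉ cards k
  symbol-avoided {x} {i} xᵢ with any? (λ k → ¬? (x ∈? cards k)) | another-symbol i x
  ... | yes avoided | _ = avoided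
  ... | no none | y , yᵢ , y≢x with another-card y i
  ... | j , yⱼ , j≢i = ⊥-elim (j≢i (common-card-unique (y≢x ∘ sym) xⱼ yⱼ xᵢ yᵢ))
    where
    xⱼ : x ∈ cards j
    xⱼ = decidable-stable (x ∈? cards j) (λ x∉ⱼ → none (j , x∉ⱼ))

  multiplicity≤order : ∀ {x i} → x ∈ cards i → multiplicity cards x ≤ n
  multiplicity≤order {x} xᵢ with symbol-avoided xᵢ
  ... | k , x∉ₖ = begin
    multiplicity cards x                              ≡⟨ multiplicity≡count cards x ⟩
    ∑[ j < c ] χ x j                                  ≡⟨ sum-cong-≗ meets-k-once ⟩
    ∑[ j < c ] (χ x j * ∣ cards j ∩ cards k ∣)        ≡⟨ ∑-weighted-∣∩∣ cards (χ x) (cards k) ⟩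
    ∑[ y < s ] (χ y k * ∑[ j < c ] (χ x j * χ y j))   ≤⟨ sum-mono-≤ one-card-through-x-and-y ⟩
    ∑[ y < s ] (χ y k * 1)                            ≡⟨ sum-cong-≗ (λ y → *-identityʳ (χ y k)) ⟩
    ∑[ y < s ] χ y k                                  ≡⟨ ∣p∣≡count (cards k) ⟨
    ∣ cards k ∣                                       ≡⟨ order k ⟩
    n                                                 ∎
    where
    open ≤-Reasoning
    meets-k-once : ∀ j → χ x j ≡ χ x j * ∣ cards j ∩ cards k ∣
    meets-k-once j with x ∈? cards j
    ... | yes xⱼ = sym (cong (1 *_) (oneCommon j k (λ j≡k → x∉ₖ (subst (λ t → x ∈ cards t) j≡k xⱼ))))
    ... | no _   = refl
    ≢y : ∀ {y} → y ∈ cards k → ¬ x ≡ y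
    ≢y yₖ refl = x∉ₖ yₖ
    one-card-through-x-and-y : ∀ y → χ y k * ∑[ j < c ] (χ x j * χ y j) ≤ χ y k * 1
    one-card-through-x-and-y y = 𝟙*-monoʳ-≤ (y ∈? cards k) (cards-through-two-symbols≤1 ∘ ≢y)

  intersectionSum : Fin c → ℕ
  intersectionSum i = ∑[ j < c ] ∣ cards j ∩ cards i ∣

  c+pred[n]≤intersectionSum : ∀ i → c + pred n ≤ intersectionSum i
  c+pred[n]≤intersectionSum i =
    subst (λ t → c + pred t ≤ intersectionSum i) (trans (cong ∣_∣ (∩-idem (cards i))) (order i))
      (size+pred≤sum (λ j → ∣ cards j ∩ cards i ∣) meets-i i)
    where
    meets-i : ∀ j → 1 ≤ ∣ cards j ∩ cards i ∣
    meets-i j with j ≟ᶠ i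
    ... | yes refl = subst (1 ≤_) (cong ∣_∣ (sym (∩-idem (cards i)))) (≤-trans (s≤s z≤n) (cardHasTwo i))
    ... | no j≢i   = ≤-reflexive (sym (oneCommon j i j≢i))

  intersectionSum≤n* : ∀ {b} i → (∀ {x} → x ∈ cards i → multiplicity cards x ≤ b) → intersectionSum i ≤ n * b
  intersectionSum≤n* {b} i m≤b = begin
    intersectionSum i
      ≡⟨ sum-cong-≗ {c} (λ j → sym (*-identityˡ ∣ cards j ∩ cards i ∣)) ⟩
    ∑[ j < c ] (1 * ∣ cards j ∩ cards i ∣)
      ≡⟨ ∑-weighted-∣∩∣ cards (λ _ → 1) (cards i) ⟩
    ∑[ y < s ] (χ y i * ∑[ j < c ] (1 * χ y j))
      ≡⟨ sum-cong-≗ (λ y → cong (χ y i *_) (multiplicity-as-sum y)) ⟩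
    ∑[ y < s ] (χ y i * multiplicity cards y)
      ≤⟨ sum-mono-≤ (λ y → 𝟙*-monoʳ-≤ (y ∈? cards i) m≤b) ⟩
    ∑[ y < s ] (χ y i * b)
      ≡⟨ *-distribʳ-sum b (λ y → χ y i) ⟨
    (∑[ y < s ] χ y i) * b
      ≡⟨ cong (_* b) (trans (sym (∣p∣≡count (cards i))) (order i)) ⟩
    n * b ∎
    where
    open ≤-Reasoning
    multiplicity-as-sum : ∀ y → ∑[ j < c ] (1 * χ y j) ≡ multiplicity cards y
    multiplicity-as-sum y = trans (sum-cong-≗ (λ j → *-identityˡ (χ y j))) (sym (multiplicity≡count cards y))

mainTheorem11 : (s c n : ℕ) (cards : Fin c → Subset s) → IsDeck s c n cards →
    (n * n + 2) ∸ (2 * n) ≤ c →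
    (i : Fin c) → Σ (Fin s) (λ x → (x ∈ cards i) × (multiplicity cards x ≡ n))
mainTheorem11 s c n cards deck c≥n*n+2∸2*n i with any? (λ x → x ∈? cards i ×-dec multiplicity cards x ≟ n)
... | yes found = found
... | no none   = ⊥-elim (<⇒≱ (n*n+2∸2*n≤c⇒n*pred[n]<c+pred[n] n c c≥n*n+2∸2*n)
                                (≤-trans (c+pred[n]≤intersectionSum i) (intersectionSum≤n* i m≤pred[n])))
  where
  open DeckProperties deck
  m≤pred[n] : ∀ {x} → x ∈ cards i → multiplicity cards x ≤ pred n
  m≤pred[n] xᵢ = <⇒≤pred (≤∧≢⇒< (multiplicity≤order xᵢ) (λ m≡n → none (_ , xᵢ , m≡n)))
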